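{- Let $n,m$ be positive integers such that there exist a Hadamard matrix of order $n$ and weighing matrices $W_1,\ldots,W_{n-1}$ of order $(n-1)m+1$ and weight $m$ satisfying $\sum_{i=1}^{n-1}|W_i|=J-I$, where $|W_i|$ is obtained from $W_i$ by replacing each $-1$ by $1$. Put $\ell=(n-1)m+1$. Then there exist twin symmetric group divisible designs $A^+,A^-$, both with parameters $\left(n\ell,\frac{n(n-1)m}{2},\ell,n,\frac{n(n-2)m}{4},\frac{n((n-1)m-1)}{4}\right)$, such that $A^++A^-+K_{\ell,n}=J_{n\ell}$ and $$A^+K_{\ell,n}=K_{\ell,n}A^+=A^-K_{\ell,n}=K_{\ell,n}A^-=\frac{n}{2}(J_{n\ell}-K_{\ell,n}).$$
   Context: $I_t$, $J_t$ denote the $t\times t$ identity and all-ones matrices; $K_{m,n}=I_m\otimes J_n$. A weighing matrix of order $N$ and weight $w$ is an $N\times N$ matrix $W$ with entries in $\{0,1,-1\}$ and $WW^\top=wI_N$. For $v=mn$, a $v\times v$ $(0,1)$-matrix $A$ is a symmetric group divisible design with parameters $(v,k,m,n,\lambda_1,\lambda_2)$ if $AA^\top=A^\top A=kI_v+\lambda_1(K_{m,n}-I_v)+\lambda_2(J_v-K_{m,n})$. Two symmetric group divisible designs $A^+,A^-$ are twin if $A^++A^-$ is a $(0,1)$-matrix. -}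

module Defs where

open import Data.Nat as ℕ using (ℕ; zero; suc)
open import Data.Fin as Fin using (Fin; quotient)
open import Data.Integer as ℤ using (ℤ; +_; -[1+_]; ∣_∣)
open import Data.Rational as ℚ using (ℚ)
open import Data.Product using (Σ; _×_; _,_)
open import Data.Sum using (_⊎_)
open import Relation.Binary.PropositionalEquality using (_≡_)
open import Relation.Nullary using (Dec; yes; no)

Mat : ℕ → Set
Mat t = Fin t → Fin t → ℤ

∑ : (t : ℕ) → (Fin t → ℤ) → ℤ
∑ zero    f = + 0
∑ (suc t) f = f Fin.zero ℤ.+ ∑ t (λ i → f (Fin.suc i))

_·_ : {t : ℕ} → Mat t → Mat t → Mat t
(A · B) i j = ∑ _ (λ k → A i k ℤ.* B k j)

_ᵀ : {t : ℕ} → Mat t → Mat t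
(A ᵀ) i j = A j i

_⊕_ : {t : ℕ} → Mat t → Mat t → Mat t
(A ⊕ B) i j = A i j ℤ.+ B i j

_⊖_ : {t : ℕ} → Mat t → Mat t → Mat t
(A ⊖ B) i j = A i j ℤ.- B i j

_•_ : {t : ℕ} → ℤ → Mat t → Mat t
(c • A) i j = c ℤ.* A i j

absM : {t : ℕ} → Mat t → Mat t
absM A i j = + ∣ A i j ∣

∑M : {t : ℕ} (r : ℕ) → (Fin r → Mat t) → Mat t
∑M r F i j = ∑ r (λ s → F s i j)

I : (t : ℕ) → Mat t
I t i j with i Fin.≟ j
... | yes _ = + 1
... | no  _ = + 0

J : (t : ℕ) → Mat t
J t i j = + 1

-- K_{a,b} = I_a ⊗ J_b, indexed by Fin (a * b) with i = (block) * b + (offset).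
K : (a b : ℕ) → Mat (a ℕ.* b)
K a b i j with quotient {a} b i Fin.≟ quotient {a} b j
... | yes _ = + 1
... | no  _ = + 0

_≐_ : {t : ℕ} → Mat t → Mat t → Set
A ≐ B = ∀ i j → A i j ≡ B i j

IsPM1 : ℤ → Set
IsPM1 x = (x ≡ + 1) ⊎ (x ≡ -[1+ 0 ])

Is01M1 : ℤ → Set
Is01M1 x = (x ≡ + 0) ⊎ IsPM1 x

Is01 : ℤ → Set
Is01 x = (x ≡ + 0) ⊎ (x ≡ + 1)

ZeroOneMatrix : {t : ℕ} → Mat t → Set
ZeroOneMatrix A = ∀ i j → Is01 (A i j)

IsHadamard : (t : ℕ) → Mat t → Set
IsHadamard t H = (∀ i j → IsPM1 (H i j)) × ((H · (H ᵀ)) ≐ ((+ t) • I t))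

IsWeighing : (t w : ℕ) → Mat t → Set
IsWeighing t w W = (∀ i j → Is01M1 (W i j)) × ((W · (W ᵀ)) ≐ ((+ w) • I t))

MatQ : ℕ → Set
MatQ t = Fin t → Fin t → ℚ

toQ : {t : ℕ} → Mat t → MatQ t
toQ A i j = A i j ℚ./ 1

-- The parameters k, λ₁, λ₂ are taken in ℚ (the paper writes them as fractions).
GDDRHS : (m n : ℕ) → (k λ₁ λ₂ : ℚ) → MatQ (m ℕ.* n)
GDDRHS m n k λ₁ λ₂ i j =
  (k ℚ.* toQ (I (m ℕ.* n)) i j)
  ℚ.+ (λ₁ ℚ.* toQ (K m n ⊖ I (m ℕ.* n)) i j)
  ℚ.+ (λ₂ ℚ.* toQ (J (m ℕ.* n) ⊖ K m n) i j)

-- (v = m n is implicit in the index type Fin (m * n).)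
IsSGDD : (k : ℚ) (m n : ℕ) (λ₁ λ₂ : ℚ) → Mat (m ℕ.* n) → Set
IsSGDD k m n λ₁ λ₂ A =
  ZeroOneMatrix A
  × (∀ i j → toQ (A · (A ᵀ)) i j ≡ GDDRHS m n k λ₁ λ₂ i j)
  × (∀ i j → toQ ((A ᵀ) · A) i j ≡ GDDRHS m n k λ₁ λ₂ i j)

module Submission where

-- Normalise the Hadamard matrix H of order n by its first row d, and let
-- u₁,…,u_r (r = n - 1) be the remaining rows multiplied entrywise by d: they
-- are ±1 vectors orthogonal to 1 and to each other, with
-- ∑ₛ uₛ(a) uₛ(b) = n δ_ab - 1 (the "Hadamard core").  With P = J_ℓ - I_ℓ put
--     B± = P ⊗ J_n ± ∑ₛ Wₛ ⊗ uₛᵀuₛ     (rows and columns indexed by Fin ℓ × Fin n).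
-- Since the supports of the Wₛ partition the off-diagonal of J_ℓ, every entry
-- of B± is 0 or 2, so A± = B±/2 are (0,1)-matrices with A⁺ + A⁻ = P ⊗ J_n.
-- Expanding 4 A Aᵀ = B Bᵀ with the core identities and Wₛ Wₛᵀ = m I gives the
-- group divisible design equation; the same computation for the transposed
-- weighing matrices (which again satisfy Wₛᵀ Wₛ = m I, by a sum-of-squares
-- argument) gives Aᵀ A.  Row sums of uₛ vanish, so A K = K A = (n/2) (P ⊗ J_n).

open import Defs
open import Data.Nat as ℕ using (ℕ; zero; suc; _≤_; _∸_; s≤s; z≤n)
import Data.Nat.Properties as ℕP
open import Data.Fin as F using (Fin; zero; suc; _↑ˡ_; _↑ʳ_; combine; quotient; remainder)
import Data.Fin.Properties as FP
open import Data.Integer as ℤ using (ℤ; +_; -[1+_]; ∣_∣; _+_; _*_; _-_; -_)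
import Data.Integer.Properties as ℤP
open import Data.Integer.Tactic.RingSolver using (solve-∀)
open import Algebra.Properties.Semiring.Sum ℤP.+-*-semiring using (sum; sum-replicate-zero; ∑-distrib-+; ∑-comm; *-distribˡ-sum; *-distribʳ-sum)
open import Data.Rational as ℚ using (toℚᵘ)
import Data.Rational.Properties as ℚP
open import Data.Rational.Unnormalised as U using (mkℚᵘ; *≡*)
import Data.Rational.Unnormalised.Properties as UP
open import Data.Product using (Σ-syntax; _×_; _,_; proj₁; proj₂)
open import Data.Sum using (_⊎_; inj₁; inj₂)
open import Function using (_∘_)
open import Relation.Nullary using (Dec; yes; no; contradiction)
open import Relation.Binary.PropositionalEquality hiding (J)
open ≡-Reasoning

∑-cong : ∀ t {f g : Fin t → ℤ} → (∀ i → f i ≡ g i) → ∑ t f ≡ ∑ t g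
∑-cong zero    f≗g = refl
∑-cong (suc t) f≗g = cong₂ _+_ (f≗g zero) (∑-cong t (f≗g ∘ suc))

-- ∑ coincides with the library's sum over the semiring ℤ, so the library's
-- summation laws transfer to it.
∑≡sum : ∀ t (f : Fin t → ℤ) → ∑ t f ≡ sum f
∑≡sum zero    f = refl
∑≡sum (suc t) f = cong (_+_ (f zero)) (∑≡sum t (f ∘ suc))

∑-+ : ∀ t (f g : Fin t → ℤ) → ∑ t (λ i → f i + g i) ≡ ∑ t f + ∑ t g
∑-+ t f g rewrite ∑≡sum t f | ∑≡sum t g | ∑≡sum t (λ i → f i + g i) = ∑-distrib-+ f g

∑-*ˡ : ∀ t (c : ℤ) (f : Fin t → ℤ) → ∑ t (λ i → c * f i) ≡ c * ∑ t f
∑-*ˡ t c f rewrite ∑≡sum t f | ∑≡sum t (λ i → c * f i) = sym (*-distribˡ-sum c f)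

∑-*ʳ : ∀ t (c : ℤ) (f : Fin t → ℤ) → ∑ t (λ i → f i * c) ≡ ∑ t f * c
∑-*ʳ t c f rewrite ∑≡sum t f | ∑≡sum t (λ i → f i * c) = sym (*-distribʳ-sum c f)

∑-zero : ∀ t → ∑ t (λ _ → + 0) ≡ + 0
∑-zero t rewrite ∑≡sum t (λ _ → + 0) = sum-replicate-zero t

∑-const : ∀ t (c : ℤ) → ∑ t (λ _ → c) ≡ + t * c
∑-const zero    c = sym (ℤP.*-zeroˡ c)
∑-const (suc t) c = trans (cong (_+_ c) (∑-const t c)) (sym (ℤP.suc-* (+ t) c))

∑-swap : ∀ a b (f : Fin a → Fin b → ℤ) →
  ∑ a (λ i → ∑ b (f i)) ≡ ∑ b (λ j → ∑ a (λ i → f i j))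
∑-swap a b f = begin
  ∑ a (λ i → ∑ b (f i))             ≡⟨ double a b f ⟩
  sum (λ i → sum (f i))             ≡⟨ ∑-comm f ⟩
  sum (λ j → sum (λ i → f i j))     ≡⟨ sym (double b a (λ j i → f i j)) ⟩
  ∑ b (λ j → ∑ a (λ i → f i j))     ∎
  where
  double : ∀ a b (g : Fin a → Fin b → ℤ) → ∑ a (λ i → ∑ b (g i)) ≡ sum (λ i → sum (g i))
  double a b g = trans (∑-cong a (λ i → ∑≡sum b (g i))) (∑≡sum a _)

∑-single : ∀ t {f : Fin t → ℤ} (j : Fin t) → (∀ k → k ≢ j → f k ≡ + 0) → ∑ t f ≡ f j
∑-single (suc t) {f} zero vanish = begin
  f zero + ∑ t (f ∘ suc)        ≡⟨ cong (_+_ (f zero)) (∑-cong t (λ k → vanish (suc k) (λ ()))) ⟩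
  f zero + ∑ t (λ _ → + 0)      ≡⟨ cong (_+_ (f zero)) (∑-zero t) ⟩
  f zero + + 0                  ≡⟨ ℤP.+-identityʳ (f zero) ⟩
  f zero                        ∎
∑-single (suc t) {f} (suc j) vanish =
  trans (cong₂ _+_ (vanish zero (λ ())) (∑-single t j (λ k k≢j → vanish (suc k) (k≢j ∘ FP.suc-injective))))
        (ℤP.+-identityˡ (f (suc j)))

∑-split : ∀ a b (f : Fin (a ℕ.+ b) → ℤ) →
  ∑ (a ℕ.+ b) f ≡ ∑ a (λ i → f (i ↑ˡ b)) + ∑ b (λ i → f (a ↑ʳ i))
∑-split zero    b f = sym (ℤP.+-identityˡ _)
∑-split (suc a) b f = trans (cong (_+_ (f zero)) (∑-split a b (f ∘ suc))) (sym (ℤP.+-assoc (f zero) _ _))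

∑-combine : ∀ a b (f : Fin (a ℕ.* b) → ℤ) → ∑ (a ℕ.* b) f ≡ ∑ a (λ x → ∑ b (λ c → f (combine x c)))
∑-combine zero    b f = refl
∑-combine (suc a) b f =
  trans (∑-split b (a ℕ.* b) f) (cong (_+_ (∑ b (λ c → f (c ↑ˡ (a ℕ.* b))))) (∑-combine a b (λ i → f (b ↑ʳ i))))

∑-product : ∀ a b (f : Fin a → ℤ) (g : Fin b → ℤ) → ∑ a f * ∑ b g ≡ ∑ a (λ i → ∑ b (λ j → f i * g j))
∑-product a b f g = trans (sym (∑-*ʳ a (∑ b g) f)) (∑-cong a (λ i → sym (∑-*ˡ b (f i) g)))

I-diag : ∀ t (i : Fin t) → I t i i ≡ + 1
I-diag t i with i F.≟ i
... | yes _   = refl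
... | no  i≢i = contradiction refl i≢i

I-off : ∀ t {i j : Fin t} → i ≢ j → I t i j ≡ + 0
I-off t {i} {j} i≢j with i F.≟ j
... | yes i≡j = contradiction i≡j i≢j
... | no  _   = refl

I-sym : ∀ t (i j : Fin t) → I t i j ≡ I t j i
I-sym t i j = by-cases (i F.≟ j)
  where
  by-cases : Dec (i ≡ j) → I t i j ≡ I t j i
  by-cases (yes refl) = refl
  by-cases (no  i≢j)  = trans (I-off t i≢j) (sym (I-off t (i≢j ∘ sym)))

I-suc : ∀ t (i j : Fin t) → I (suc t) (suc i) (suc j) ≡ I t i j
I-suc t i j = by-cases (i F.≟ j)
  where
  by-cases : Dec (i ≡ j) → I (suc t) (suc i) (suc j) ≡ I t i j
  by-cases (yes refl) = trans (I-diag (suc t) (suc i)) (sym (I-diag t i))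
  by-cases (no  i≢j)  = trans (I-off (suc t) (i≢j ∘ FP.suc-injective)) (sym (I-off t i≢j))

∑-δʳ : ∀ t (f : Fin t → ℤ) (j : Fin t) → ∑ t (λ k → f k * I t k j) ≡ f j
∑-δʳ t f j = begin
  ∑ t (λ k → f k * I t k j) ≡⟨ ∑-single t j (λ k k≢j → trans (cong (f k *_) (I-off t k≢j)) (ℤP.*-zeroʳ (f k))) ⟩
  f j * I t j j             ≡⟨ cong (f j *_) (I-diag t j) ⟩
  f j * + 1                 ≡⟨ ℤP.*-identityʳ (f j) ⟩
  f j                       ∎

∑-δˡ : ∀ t (f : Fin t → ℤ) (j : Fin t) → ∑ t (λ k → I t j k * f k) ≡ f j
∑-δˡ t f j = trans (∑-cong t (λ k → trans (ℤP.*-comm (I t j k) (f k)) (cong (f k *_) (I-sym t j k)))) (∑-δʳ t f j)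

±1-* : ∀ {a b} → IsPM1 a → IsPM1 b → IsPM1 (a * b)
±1-* (inj₁ refl) (inj₁ refl) = inj₁ refl
±1-* (inj₁ refl) (inj₂ refl) = inj₂ refl
±1-* (inj₂ refl) (inj₁ refl) = inj₂ refl
±1-* (inj₂ refl) (inj₂ refl) = inj₁ refl

±1-square : ∀ {a} → IsPM1 a → a * a ≡ + 1
±1-square (inj₁ refl) = refl
±1-square (inj₂ refl) = refl

0±1-neg : ∀ {w} → Is01M1 w → Is01M1 (- w)
0±1-neg (inj₁ refl)        = inj₁ refl
0±1-neg (inj₂ (inj₁ refl)) = inj₂ (inj₂ refl)
0±1-neg (inj₂ (inj₂ refl)) = inj₂ (inj₁ refl)

0±1-nonzero : ∀ {w} → Is01M1 w → ∣ w ∣ ≡ 1 → IsPM1 w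
0±1-nonzero (inj₁ refl) ()
0±1-nonzero (inj₂ w-±1) _ = w-±1

-- Halving on {0, 2}: the entries of the designs are half those of B.
half : ℤ → ℤ
half (+ 2) = + 1
half _     = + 0

half-01 : ∀ v → Is01 (half v)
half-01 (+ 2)                 = inj₂ refl
half-01 (+ 0)                 = inj₁ refl
half-01 (+ 1)                 = inj₁ refl
half-01 (+ suc (suc (suc _))) = inj₁ refl
half-01 -[1+ _ ]              = inj₁ refl

twice-half : ∀ {v} → (v ≡ + 0) ⊎ (v ≡ + 2) → + 2 * half v ≡ v
twice-half (inj₁ refl) = refl
twice-half (inj₂ refl) = refl

∑ℕ : (t : ℕ) → (Fin t → ℕ) → ℕ
∑ℕ zero    g = 0
∑ℕ (suc t) g = g zero ℕ.+ ∑ℕ t (g ∘ suc)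

∑-pos : ∀ t (g : Fin t → ℕ) → ∑ t (λ i → + g i) ≡ + ∑ℕ t g
∑-pos zero    g = refl
∑-pos (suc t) g = trans (cong (_+_ (+ g zero)) (∑-pos t (g ∘ suc))) (sym (ℤP.pos-+ (g zero) _))

∑ℕ≡0 : ∀ t (g : Fin t → ℕ) → ∑ℕ t g ≡ 0 → ∀ i → g i ≡ 0
∑ℕ≡0 (suc t) g sum≡0 zero    = ℕP.m+n≡0⇒m≡0 (g zero) sum≡0
∑ℕ≡0 (suc t) g sum≡0 (suc i) = ∑ℕ≡0 t (g ∘ suc) (ℕP.m+n≡0⇒n≡0 (g zero) sum≡0) i

∑ℕ≡1 : ∀ t (g : Fin t → ℕ) → ∑ℕ t g ≡ 1 → Σ[ s₀ ∈ Fin t ] (g s₀ ≡ 1 × (∀ s → s ≢ s₀ → g s ≡ 0))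
∑ℕ≡1 (suc t) g sum≡1 with g zero in g₀
... | 0 with ∑ℕ≡1 t (g ∘ suc) sum≡1
...   | s₀ , gs₀≡1 , others = suc s₀ , gs₀≡1 , λ { zero _ → g₀ ; (suc s) s≢s₀ → others s (s≢s₀ ∘ cong suc) }
∑ℕ≡1 (suc t) g sum≡1 | 1 =
  zero , g₀ , λ { zero 0≢0 → contradiction refl 0≢0 ; (suc s) _ → ∑ℕ≡0 t (g ∘ suc) (ℕP.suc-injective sum≡1) s }
∑ℕ≡1 (suc t) g sum≡1 | suc (suc _) with ℕP.suc-injective sum≡1
... | ()

sum-of-squares-zero : ∀ t (C : Fin t → Fin t → ℤ) →
  ∑ t (λ i → ∑ t (λ j → C i j * C i j)) ≡ + 0 → ∀ i j → C i j ≡ + 0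
sum-of-squares-zero t C total≡0 i j = square≡0 (C i j) (∑ℕ≡0 t _ (∑ℕ≡0 t _ totalℕ≡0 i) j)
  where
  square : ∀ x → x * x ≡ + (∣ x ∣ ℕ.* ∣ x ∣)
  square (+ zero)  = refl
  square (+ suc _) = refl
  square -[1+ _ ]  = refl
  square≡0 : ∀ x → ∣ x ∣ ℕ.* ∣ x ∣ ≡ 0 → x ≡ + 0
  square≡0 x sq≡0 with ℕP.m*n≡0⇒m≡0∨n≡0 ∣ x ∣ sq≡0
  ... | inj₁ ∣x∣≡0 = ℤP.∣i∣≡0⇒i≡0 ∣x∣≡0
  ... | inj₂ ∣x∣≡0 = ℤP.∣i∣≡0⇒i≡0 ∣x∣≡0
  g : Fin t → Fin t → ℕ
  g i j = ∣ C i j ∣ ℕ.* ∣ C i j ∣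
  totalℕ≡0 : ∑ℕ t (λ i → ∑ℕ t (g i)) ≡ 0
  totalℕ≡0 = ℤP.+-injective (begin
    + ∑ℕ t (λ i → ∑ℕ t (g i))               ≡⟨ sym (∑-pos t _) ⟩
    ∑ t (λ i → + ∑ℕ t (g i))                ≡⟨ sym (∑-cong t (λ i → trans (∑-cong t (λ j → square (C i j))) (∑-pos t (g i)))) ⟩
    ∑ t (λ i → ∑ t (λ j → C i j * C i j))   ≡⟨ total≡0 ⟩
    + 0                                     ∎)

-- With B = Mᵀ M one has B² = c B and tr B = t c, hence
--   ∑ᵢⱼ (B - c I)ᵢⱼ² = tr B² - 2c tr B + t c² = 0,
-- so B = c I.

module ColumnOrthogonality (t : ℕ) (M : Mat t) (c : ℤ)
  (rows : ∀ i j → ∑ t (λ k → M i k * M j k) ≡ c * I t i j) where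

  B : Mat t
  B i j = ∑ t (λ k → M k i * M k j)

  B-sym : ∀ i j → B i j ≡ B j i
  B-sym i j = ∑-cong t (λ k → ℤP.*-comm (M k i) (M k j))

  -- B² = c B, from (Mᵀ M)(Mᵀ M) = Mᵀ (M Mᵀ) M.
  B-square : ∀ i j → ∑ t (λ l → B i l * B l j) ≡ c * B i j
  B-square i j = begin
    ∑ t (λ l → B i l * B l j)
      ≡⟨ ∑-cong t (λ l → ∑-product t t _ _) ⟩
    ∑ t (λ l → ∑ t (λ k → ∑ t (λ p → (M k i * M k l) * (M p l * M p j))))
      ≡⟨ ∑-swap t t _ ⟩
    ∑ t (λ k → ∑ t (λ l → ∑ t (λ p → (M k i * M k l) * (M p l * M p j))))
      ≡⟨ ∑-cong t (λ k → ∑-swap t t _) ⟩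
    ∑ t (λ k → ∑ t (λ p → ∑ t (λ l → (M k i * M k l) * (M p l * M p j))))
      ≡⟨ ∑-cong t (λ k → ∑-cong t (λ p → trans (∑-cong t (λ l → regroup (M k i) (M k l) (M p l) (M p j)))
                                                 (∑-*ˡ t (M k i * M p j) (λ l → M k l * M p l)))) ⟩
    ∑ t (λ k → ∑ t (λ p → (M k i * M p j) * ∑ t (λ l → M k l * M p l)))
      ≡⟨ ∑-cong t (λ k → ∑-cong t (λ p → cong ((M k i * M p j) *_) (rows k p))) ⟩
    ∑ t (λ k → ∑ t (λ p → (M k i * M p j) * (c * I t k p)))
      ≡⟨ ∑-cong t (λ k → trans (∑-cong t (λ p → move-δ (M k i) (M p j) c (I t k p))) (∑-δˡ t _ k)) ⟩
    ∑ t (λ k → c * (M k i * M k j))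
      ≡⟨ ∑-*ˡ t c _ ⟩
    c * B i j ∎
    where
    regroup : ∀ a b x y → (a * b) * (x * y) ≡ (a * y) * (b * x)
    regroup = solve-∀
    move-δ : ∀ a b c δ → (a * b) * (c * δ) ≡ δ * (c * (a * b))
    move-δ = solve-∀

  trace-B : ∑ t (λ i → B i i) ≡ + t * c
  trace-B = begin
    ∑ t (λ i → ∑ t (λ k → M k i * M k i)) ≡⟨ ∑-swap t t _ ⟩
    ∑ t (λ k → ∑ t (λ i → M k i * M k i)) ≡⟨ ∑-cong t (λ k → trans (rows k k) (trans (cong (c *_) (I-diag t k)) (ℤP.*-identityʳ c))) ⟩
    ∑ t (λ _ → c)                         ≡⟨ ∑-const t c ⟩
    + t * c                               ∎

  D : Mat t
  D i j = B i j - c * I t i j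

  D-row : ∀ i → ∑ t (λ j → D i j * D i j) ≡ c * c + (- c) * B i i
  D-row i = begin
    ∑ t (λ j → D i j * D i j)
      ≡⟨ ∑-cong t square-entry ⟩
    ∑ t (λ j → B i j * B j i + I t i j * (c * I t i j * c - + 2 * c * B i j))
      ≡⟨ ∑-+ t _ _ ⟩
    ∑ t (λ j → B i j * B j i) + ∑ t (λ j → I t i j * (c * I t i j * c - + 2 * c * B i j))
      ≡⟨ cong₂ _+_ (B-square i i) (∑-δˡ t (λ j → c * I t i j * c - + 2 * c * B i j) i) ⟩
    c * B i i + (c * I t i i * c - + 2 * c * B i i)
      ≡⟨ cong (λ δ → c * B i i + (c * δ * c - + 2 * c * B i i)) (I-diag t i) ⟩
    c * B i i + (c * + 1 * c - + 2 * c * B i i)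
      ≡⟨ collect c (B i i) ⟩
    c * c + (- c) * B i i ∎
    where
    expand : ∀ b c δ → (b - c * δ) * (b - c * δ) ≡ b * b + δ * (c * δ * c - + 2 * c * b)
    expand = solve-∀
    square-entry : ∀ j → D i j * D i j ≡ B i j * B j i + I t i j * (c * I t i j * c - + 2 * c * B i j)
    square-entry j = trans (expand (B i j) c (I t i j)) (cong (λ b → B i j * b + I t i j * (c * I t i j * c - + 2 * c * B i j)) (B-sym i j))
    collect : ∀ c b → c * b + (c * + 1 * c - + 2 * c * b) ≡ c * c + (- c) * b
    collect = solve-∀

  D-total : ∑ t (λ i → ∑ t (λ j → D i j * D i j)) ≡ + 0
  D-total = begin
    ∑ t (λ i → ∑ t (λ j → D i j * D i j))             ≡⟨ trans (∑-cong t D-row) (∑-+ t _ _) ⟩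
    ∑ t (λ _ → c * c) + ∑ t (λ i → (- c) * B i i)     ≡⟨ cong₂ _+_ (∑-const t _) (∑-*ˡ t (- c) (λ i → B i i)) ⟩
    + t * (c * c) + (- c) * ∑ t (λ i → B i i)         ≡⟨ cong (λ τ → + t * (c * c) + (- c) * τ) trace-B ⟩
    + t * (c * c) + (- c) * (+ t * c)                 ≡⟨ cancel (+ t) c ⟩
    + 0                                               ∎
    where
    cancel : ∀ t c → t * (c * c) + (- c) * (t * c) ≡ + 0
    cancel = solve-∀

  columns : ∀ i j → B i j ≡ c * I t i j
  columns i j = begin
    B i j                 ≡⟨ add-back (B i j) (c * I t i j) ⟩
    D i j + c * I t i j   ≡⟨ cong (_+ c * I t i j) (sum-of-squares-zero t D D-total i j) ⟩
    + 0 + c * I t i j     ≡⟨ ℤP.+-identityˡ _ ⟩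
    c * I t i j           ∎
    where
    add-back : ∀ b e → b ≡ (b - e) + e
    add-back = solve-∀

orthogonal-columns : ∀ t (M : Mat t) (c : ℤ) →
  (∀ i j → ∑ t (λ k → M i k * M j k) ≡ c * I t i j) →
  ∀ i j → ∑ t (λ k → M k i * M k j) ≡ c * I t i j
orthogonal-columns t M c rows = ColumnOrthogonality.columns t M c rows

record HadamardCore (n r : ℕ) : Set where
  field
    u       : Fin r → Fin n → ℤ
    u-±1    : ∀ s a → IsPM1 (u s a)
    u-sum   : ∀ s → ∑ n (u s) ≡ + 0
    u-orth  : ∀ s t → ∑ n (λ c → u s c * u t c) ≡ + n * I r s t
    u-cols  : ∀ a b → ∑ r (λ s → u s a * u s b) ≡ + n * I n a b - + 1

δ-absorbs-±1 : ∀ t (d : Fin t → ℤ) → (∀ a → IsPM1 (d a)) →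
  ∀ a b (x : ℤ) → (d a * d b) * (x * I t a b) ≡ x * I t a b
δ-absorbs-±1 t d d-±1 a b x = by-cases (a F.≟ b)
  where
  zero-absorbs : ∀ p x → p * (x * + 0) ≡ x * + 0
  zero-absorbs = solve-∀
  by-cases : Dec (a ≡ b) → (d a * d b) * (x * I t a b) ≡ x * I t a b
  by-cases (yes refl) = trans (cong (_* (x * I t a a)) (±1-square (d-±1 a))) (ℤP.*-identityˡ _)
  by-cases (no  a≢b)  = begin
    (d a * d b) * (x * I t a b) ≡⟨ cong (λ δ → (d a * d b) * (x * δ)) (I-off t a≢b) ⟩
    (d a * d b) * (x * + 0)     ≡⟨ zero-absorbs (d a * d b) x ⟩
    x * + 0                     ≡⟨ cong (x *_) (sym (I-off t a≢b)) ⟩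
    x * I t a b                 ∎

hadamard-core : ∀ r (H : Mat (suc r)) → IsHadamard (suc r) H → HadamardCore (suc r) r
hadamard-core r H (H-±1 , H-rows) = record
  { u = u ; u-±1 = u-±1 ; u-sum = u-sum ; u-orth = u-orth ; u-cols = u-cols }
  where
  n = suc r

  d : Fin n → ℤ
  d c = H zero c

  u : Fin r → Fin n → ℤ
  u s c = H (suc s) c * d c

  u-±1 : ∀ s a → IsPM1 (u s a)
  u-±1 s a = ±1-* (H-±1 (suc s) a) (H-±1 zero a)

  -- Row s + 1 of H is orthogonal to row 0.
  u-sum : ∀ s → ∑ n (u s) ≡ + 0
  u-sum s = trans (H-rows (suc s) zero) (trans (cong (+ n *_) (I-off n {suc s} {zero} (λ ()))) (ℤP.*-zeroʳ (+ n)))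

  u-orth : ∀ s t → ∑ n (λ c → u s c * u t c) ≡ + n * I r s t
  u-orth s t = begin
    ∑ n (λ c → u s c * u t c)                ≡⟨ ∑-cong n {g = λ c → H (suc s) c * H (suc t) c} (λ c → trans (regroup (H (suc s) c) (H (suc t) c) (d c))
                                                   (trans (cong (H (suc s) c * H (suc t) c *_) (±1-square (H-±1 zero c)))
                                                          (ℤP.*-identityʳ _))) ⟩
    ∑ n (λ c → H (suc s) c * H (suc t) c)    ≡⟨ H-rows (suc s) (suc t) ⟩
    + n * I n (suc s) (suc t)                ≡⟨ cong (+ n *_) (I-suc r s t) ⟩
    + n * I r s t                            ∎
    where
    regroup : ∀ a b e → (a * e) * (b * e) ≡ a * b * (e * e)
    regroup = solve-∀

  -- Column products of the normalised matrix: the columns of H are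
  -- orthogonal, and the first (normalised) row contributes exactly 1.
  u-cols : ∀ a b → ∑ r (λ s → u s a * u s b) ≡ + n * I n a b - + 1
  u-cols a b = begin
    rest                      ≡⟨ add-one rest ⟩
    (+ 1 + rest) - + 1        ≡⟨ cong (λ w → (w + rest) - + 1) (sym first-row) ⟩
    ∑ n g - + 1               ≡⟨ cong (_- + 1) all-rows ⟩
    + n * I n a b - + 1       ∎
    where
    g : Fin n → ℤ
    g i = (H i a * d a) * (H i b * d b)
    rest = ∑ r (g ∘ suc)
    add-one : ∀ x → x ≡ (+ 1 + x) - + 1
    add-one = solve-∀
    first-row : g zero ≡ + 1
    first-row = cong₂ _*_ (±1-square (H-±1 zero a)) (±1-square (H-±1 zero b))
    regroup : ∀ x e y f → (x * e) * (y * f) ≡ (e * f) * (x * y)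
    regroup = solve-∀
    all-rows : ∑ n g ≡ + n * I n a b
    all-rows = begin
      ∑ n g                                     ≡⟨ ∑-cong n (λ i → regroup (H i a) (d a) (H i b) (d b)) ⟩
      ∑ n (λ i → (d a * d b) * (H i a * H i b)) ≡⟨ ∑-*ˡ n (d a * d b) (λ i → H i a * H i b) ⟩
      (d a * d b) * ∑ n (λ i → H i a * H i b)   ≡⟨ cong ((d a * d b) *_) (orthogonal-columns n H (+ n) H-rows a b) ⟩
      (d a * d b) * (+ n * I n a b)             ≡⟨ δ-absorbs-±1 n d (H-±1 zero) a b (+ n) ⟩
      + n * I n a b                             ∎

-- The Gram matrix of B = P ⊗ J + ∑ₛ Wₛ ⊗ uₛᵀuₛ, where P = J - I.
-- Rows and columns of B are indexed by pairs (x, a) ∈ Fin ℓ × Fin n.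

∑-shifted-product : ∀ n (p q : ℤ) (f g : Fin n → ℤ) →
  ∑ n (λ c → (p + f c) * (q + g c)) ≡ + n * (p * q) + (p * ∑ n g + q * ∑ n f) + ∑ n (λ c → f c * g c)
∑-shifted-product n p q f g = begin
  ∑ n (λ c → (p + f c) * (q + g c))
    ≡⟨ ∑-cong n (λ c → expand p q (f c) (g c)) ⟩
  ∑ n (λ c → p * q + (p * g c + q * f c) + f c * g c)
    ≡⟨ ∑-+ n _ _ ⟩
  ∑ n (λ c → p * q + (p * g c + q * f c)) + ∑ n (λ c → f c * g c)
    ≡⟨ cong (_+ ∑ n (λ c → f c * g c)) (trans (∑-+ n _ _) (cong₂ _+_ (∑-const n _)
         (trans (∑-+ n _ _) (cong₂ _+_ (∑-*ˡ n p g) (∑-*ˡ n q f))))) ⟩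
  + n * (p * q) + (p * ∑ n g + q * ∑ n f) + ∑ n (λ c → f c * g c) ∎
  where
  expand : ∀ p q x y → (p + x) * (q + y) ≡ p * q + (p * y + q * x) + x * y
  expand = solve-∀

-- The value of 4 A Aᵀ (and of 4 Aᵀ A) at ((x, a), (y, b)).
gram-value : (ℓ n m : ℕ) → Fin ℓ → Fin n → Fin ℓ → Fin n → ℤ
gram-value ℓ n m x a y b = + n * (+ ℓ - + 2 + I ℓ x y) + + n * ((+ m * I ℓ x y) * (+ n * I n a b - + 1))

module BlockGram {ℓ n r : ℕ} (core : HadamardCore n r) (m : ℕ) (W : Fin r → Mat ℓ)
  (W-rows : ∀ s x y → ∑ ℓ (λ z → W s x z * W s y z) ≡ + m * I ℓ x y) where

  open HadamardCore core

  P : Fin ℓ → Fin ℓ → ℤ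
  P x z = + 1 - I ℓ x z

  S : Fin ℓ → Fin n → Fin ℓ → Fin n → ℤ
  S x a z c = ∑ r (λ s → W s x z * (u s a * u s c))

  B : Fin ℓ → Fin n → Fin ℓ → Fin n → ℤ
  B x a z c = P x z + S x a z c

  combination-sum : ∀ (α : Fin r → ℤ) → ∑ n (λ c → ∑ r (λ s → α s * u s c)) ≡ + 0
  combination-sum α = begin
    ∑ n (λ c → ∑ r (λ s → α s * u s c)) ≡⟨ ∑-swap n r _ ⟩
    ∑ r (λ s → ∑ n (λ c → α s * u s c)) ≡⟨ ∑-cong r (λ s → trans (∑-*ˡ n (α s) (u s))
                                             (trans (cong (α s *_) (u-sum s)) (ℤP.*-zeroʳ (α s)))) ⟩
    ∑ r (λ _ → + 0)                     ≡⟨ ∑-zero r ⟩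
    + 0                                 ∎

  combination-inner : ∀ (α β : Fin r → ℤ) →
    ∑ n (λ c → ∑ r (λ s → α s * u s c) * ∑ r (λ t → β t * u t c)) ≡ + n * ∑ r (λ s → α s * β s)
  combination-inner α β = begin
    ∑ n (λ c → ∑ r (λ s → α s * u s c) * ∑ r (λ t → β t * u t c))
      ≡⟨ ∑-cong n (λ c → ∑-product r r _ _) ⟩
    ∑ n (λ c → ∑ r (λ s → ∑ r (λ t → (α s * u s c) * (β t * u t c))))
      ≡⟨ trans (∑-swap n r _) (∑-cong r (λ s → ∑-swap n r _)) ⟩
    ∑ r (λ s → ∑ r (λ t → ∑ n (λ c → (α s * u s c) * (β t * u t c))))
      ≡⟨ ∑-cong r (λ s → ∑-cong r (λ t → trans (∑-cong n (λ c → regroup (α s) (u s c) (β t) (u t c)))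
                                                (∑-*ˡ n (α s * β t) (λ c → u s c * u t c)))) ⟩
    ∑ r (λ s → ∑ r (λ t → (α s * β t) * ∑ n (λ c → u s c * u t c)))
      ≡⟨ ∑-cong r (λ s → ∑-cong r (λ t → trans (cong ((α s * β t) *_) (u-orth s t)) (move-δ (α s) (β t) (+ n) (I r s t)))) ⟩
    ∑ r (λ s → ∑ r (λ t → I r s t * (+ n * (α s * β t))))
      ≡⟨ ∑-cong r (λ s → ∑-δˡ r (λ t → + n * (α s * β t)) s) ⟩
    ∑ r (λ s → + n * (α s * β s))
      ≡⟨ ∑-*ˡ r (+ n) _ ⟩
    + n * ∑ r (λ s → α s * β s) ∎
    where
    regroup : ∀ a x b y → (a * x) * (b * y) ≡ (a * b) * (x * y)
    regroup = solve-∀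
    move-δ : ∀ a b n δ → (a * b) * (n * δ) ≡ δ * (n * (a * b))
    move-δ = solve-∀

  S-combinationʳ : ∀ x a z c → S x a z c ≡ ∑ r (λ s → (W s x z * u s a) * u s c)
  S-combinationʳ x a z c = ∑-cong r (λ s → sym (ℤP.*-assoc (W s x z) (u s a) (u s c)))

  S-combinationˡ : ∀ x a z c → S x a z c ≡ ∑ r (λ s → (W s x z * u s c) * u s a)
  S-combinationˡ x a z c = ∑-cong r (λ s → swap (W s x z) (u s a) (u s c))
    where
    swap : ∀ w a c → w * (a * c) ≡ (w * c) * a
    swap = solve-∀

  S-sumʳ : ∀ x a z → ∑ n (S x a z) ≡ + 0
  S-sumʳ x a z = trans (∑-cong n (S-combinationʳ x a z)) (combination-sum (λ s → W s x z * u s a))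

  S-sumˡ : ∀ x z c → ∑ n (λ a → S x a z c) ≡ + 0
  S-sumˡ x z c = trans (∑-cong n (λ a → S-combinationˡ x a z c)) (combination-sum (λ s → W s x z * u s c))

  block-inner : ∀ x a y b z →
    ∑ n (λ c → B x a z c * B y b z c) ≡ + n * (P x z * P y z) + + n * ∑ r (λ s → (W s x z * W s y z) * (u s a * u s b))
  block-inner x a y b z = begin
    ∑ n (λ c → B x a z c * B y b z c)
      ≡⟨ ∑-shifted-product n (P x z) (P y z) (S x a z) (S y b z) ⟩
    + n * (P x z * P y z) + (P x z * ∑ n (S y b z) + P y z * ∑ n (S x a z)) + ∑ n (λ c → S x a z c * S y b z c)
      ≡⟨ cong₂ (λ σ τ → + n * (P x z * P y z) + (P x z * σ + P y z * τ) + ∑ n (λ c → S x a z c * S y b z c))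
               (S-sumʳ y b z) (S-sumʳ x a z) ⟩
    + n * (P x z * P y z) + (P x z * + 0 + P y z * + 0) + ∑ n (λ c → S x a z c * S y b z c)
      ≡⟨ cong (_+ ∑ n (λ c → S x a z c * S y b z c)) (drop-zeros (+ n * (P x z * P y z)) (P x z) (P y z)) ⟩
    + n * (P x z * P y z) + ∑ n (λ c → S x a z c * S y b z c)
      ≡⟨ cong (_+_ (+ n * (P x z * P y z)))
           (trans (∑-cong n (λ c → cong₂ _*_ (S-combinationʳ x a z c) (S-combinationʳ y b z c)))
                  (combination-inner (λ s → W s x z * u s a) (λ s → W s y z * u s b))) ⟩
    + n * (P x z * P y z) + + n * ∑ r (λ s → (W s x z * u s a) * (W s y z * u s b))
      ≡⟨ cong (λ σ → + n * (P x z * P y z) + + n * σ) (∑-cong r (λ s → regroup (W s x z) (u s a) (W s y z) (u s b))) ⟩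
    + n * (P x z * P y z) + + n * ∑ r (λ s → (W s x z * W s y z) * (u s a * u s b)) ∎
    where
    drop-zeros : ∀ k p q → k + (p * + 0 + q * + 0) ≡ k
    drop-zeros = solve-∀
    regroup : ∀ a x b y → (a * x) * (b * y) ≡ (a * b) * (x * y)
    regroup = solve-∀

  P-gram : ∀ x y → ∑ ℓ (λ z → P x z * P y z) ≡ + ℓ - + 2 + I ℓ x y
  P-gram x y = begin
    ∑ ℓ (λ z → P x z * P y z)
      ≡⟨ ∑-cong ℓ (λ z → expand (I ℓ x z) (I ℓ y z)) ⟩
    ∑ ℓ (λ z → (+ 1 + (I ℓ x z * -[1+ 0 ] + I ℓ y z * -[1+ 0 ])) + I ℓ x z * I ℓ y z)
      ≡⟨ trans (∑-+ ℓ _ _) (cong₂ _+_ (trans (∑-+ ℓ _ _) (cong₂ _+_ (∑-const ℓ (+ 1))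
           (trans (∑-+ ℓ _ _) (cong₂ _+_ (∑-δˡ ℓ (λ _ → -[1+ 0 ]) x) (∑-δˡ ℓ (λ _ → -[1+ 0 ]) y)))))
           (∑-δˡ ℓ (I ℓ y) x)) ⟩
    + ℓ * + 1 + (-[1+ 0 ] + -[1+ 0 ]) + I ℓ y x
      ≡⟨ cong₂ _+_ (simplify (+ ℓ)) (I-sym ℓ y x) ⟩
    + ℓ - + 2 + I ℓ x y ∎
    where
    expand : ∀ i j → (+ 1 - i) * (+ 1 - j) ≡ (+ 1 + (i * -[1+ 0 ] + j * -[1+ 0 ])) + i * j
    expand = solve-∀
    simplify : ∀ l → l * + 1 + (-[1+ 0 ] + -[1+ 0 ]) ≡ l - + 2
    simplify = solve-∀

  -- B Bᵀ, using Wₛ Wₛᵀ = m I and the column products of the core.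
  gram : ∀ x a y b → ∑ ℓ (λ z → ∑ n (λ c → B x a z c * B y b z c)) ≡ gram-value ℓ n m x a y b
  gram x a y b = begin
    ∑ ℓ (λ z → ∑ n (λ c → B x a z c * B y b z c))
      ≡⟨ trans (∑-cong ℓ (block-inner x a y b)) (∑-+ ℓ _ _) ⟩
    ∑ ℓ (λ z → + n * (P x z * P y z)) + ∑ ℓ (λ z → + n * ∑ r (λ s → (W s x z * W s y z) * (u s a * u s b)))
      ≡⟨ cong₂ _+_ (trans (∑-*ˡ ℓ (+ n) _) (cong (+ n *_) (P-gram x y)))
                   (trans (∑-*ˡ ℓ (+ n) _) (cong (+ n *_) weighing-part)) ⟩
    gram-value ℓ n m x a y b ∎
    where
    weighing-part : ∑ ℓ (λ z → ∑ r (λ s → (W s x z * W s y z) * (u s a * u s b)))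
                    ≡ (+ m * I ℓ x y) * (+ n * I n a b - + 1)
    weighing-part = begin
      ∑ ℓ (λ z → ∑ r (λ s → (W s x z * W s y z) * (u s a * u s b)))
        ≡⟨ ∑-swap ℓ r _ ⟩
      ∑ r (λ s → ∑ ℓ (λ z → (W s x z * W s y z) * (u s a * u s b)))
        ≡⟨ ∑-cong r (λ s → trans (∑-*ʳ ℓ _ _) (cong (_* (u s a * u s b)) (W-rows s x y))) ⟩
      ∑ r (λ s → (+ m * I ℓ x y) * (u s a * u s b))
        ≡⟨ trans (∑-*ˡ r (+ m * I ℓ x y) (λ s → u s a * u s b)) (cong ((+ m * I ℓ x y) *_) (u-cols a b)) ⟩
      (+ m * I ℓ x y) * (+ n * I n a b - + 1) ∎

  B-row-sum : ∀ x a z → ∑ n (B x a z) ≡ + n * P x z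
  B-row-sum x a z = trans (∑-+ n _ _) (trans (cong₂ _+_ (∑-const n (P x z)) (S-sumʳ x a z)) (ℤP.+-identityʳ _))

  B-col-sum : ∀ x z c → ∑ n (λ a → B x a z c) ≡ + n * P x z
  B-col-sum x z c = trans (∑-+ n _ _) (trans (cong₂ _+_ (∑-const n (P x z)) (S-sumˡ x z c)) (ℤP.+-identityʳ _))

module WeighingSupport {ℓ r : ℕ} (W : Fin r → Mat ℓ)
  (W-entries : ∀ s x y → Is01M1 (W s x y))
  (W-support : ∑M r (λ s → absM (W s)) ≐ (J ℓ ⊖ I ℓ)) where

  abs-sum : ∀ x y → + ∑ℕ r (λ s → ∣ W s x y ∣) ≡ + 1 - I ℓ x y
  abs-sum x y = trans (sym (∑-pos r _)) (W-support x y)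

  diagonal-zero : ∀ s x → W s x x ≡ + 0
  diagonal-zero s x = ℤP.∣i∣≡0⇒i≡0 (∑ℕ≡0 r _ (ℤP.+-injective (trans (abs-sum x x) (cong (λ δ → + 1 - δ) (I-diag ℓ x)))) s)

  unique-support : ∀ {x y} → x ≢ y → Σ[ s₀ ∈ Fin r ] (IsPM1 (W s₀ x y) × (∀ s → s ≢ s₀ → W s x y ≡ + 0))
  unique-support {x} {y} x≢y
    with ∑ℕ≡1 r _ (ℤP.+-injective (trans (abs-sum x y) (cong (λ δ → + 1 - δ) (I-off ℓ x≢y))))
  ... | s₀ , ∣W∣≡1 , others = s₀ , 0±1-nonzero (W-entries s₀ x y) ∣W∣≡1 , λ s s≢s₀ → ℤP.∣i∣≡0⇒i≡0 (others s s≢s₀)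

-- Kronecker indexing: Fin (ℓ * n) ≅ Fin ℓ × Fin n via quotient q and
-- remainder ρ, under which K ℓ n = I ℓ ⊗ J n and I (ℓ * n) = I ℓ ⊗ I n.

module KroneckerIndex (ℓ n : ℕ) where

  q : Fin (ℓ ℕ.* n) → Fin ℓ
  q = quotient {ℓ} n

  ρ : Fin (ℓ ℕ.* n) → Fin n
  ρ = remainder {ℓ} n

  K-as-δ : ∀ i j → K ℓ n i j ≡ I ℓ (q i) (q j)
  K-as-δ i j with q i F.≟ q j
  ... | yes _ = refl
  ... | no  _ = refl

  I-kronecker : ∀ i j → I ℓ (q i) (q j) * I n (ρ i) (ρ j) ≡ I (ℓ ℕ.* n) i j
  I-kronecker i j = by-cases (q i F.≟ q j) (ρ i F.≟ ρ j)
    where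
    by-cases : Dec (q i ≡ q j) → Dec (ρ i ≡ ρ j) → I ℓ (q i) (q j) * I n (ρ i) (ρ j) ≡ I (ℓ ℕ.* n) i j
    by-cases (yes qi≡qj) (yes ρi≡ρj) = begin
      I ℓ (q i) (q j) * I n (ρ i) (ρ j) ≡⟨ cong₂ _*_ (cong (λ x → I ℓ x (q j)) qi≡qj) (cong (λ c → I n c (ρ j)) ρi≡ρj) ⟩
      I ℓ (q j) (q j) * I n (ρ j) (ρ j) ≡⟨ cong₂ _*_ (I-diag ℓ (q j)) (I-diag n (ρ j)) ⟩
      + 1                               ≡⟨ sym (I-diag (ℓ ℕ.* n) j) ⟩
      I (ℓ ℕ.* n) j j                   ≡⟨ cong (λ k → I (ℓ ℕ.* n) k j) (sym i≡j) ⟩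
      I (ℓ ℕ.* n) i j                   ∎
      where
      i≡j : i ≡ j
      i≡j = trans (sym (FP.combine-remQuot {ℓ} n i))
                  (trans (cong₂ combine qi≡qj ρi≡ρj) (FP.combine-remQuot {ℓ} n j))
    by-cases (yes _) (no ρi≢ρj) =
      trans (cong (I ℓ (q i) (q j) *_) (I-off n ρi≢ρj))
            (trans (ℤP.*-zeroʳ (I ℓ (q i) (q j))) (sym (I-off (ℓ ℕ.* n) (ρi≢ρj ∘ cong ρ))))
    by-cases (no qi≢qj) _ =
      trans (cong (_* I n (ρ i) (ρ j)) (I-off ℓ qi≢qj)) (sym (I-off (ℓ ℕ.* n) (qi≢qj ∘ cong q)))

  ∑-pairs : ∀ (f : Fin ℓ → Fin n → ℤ) → ∑ (ℓ ℕ.* n) (λ k → f (q k) (ρ k)) ≡ ∑ ℓ (λ z → ∑ n (f z))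
  ∑-pairs f = trans (∑-combine ℓ n _) (∑-cong ℓ (λ z → ∑-cong n (λ c →
    cong₂ f (cong proj₁ (FP.remQuot-combine {ℓ} {n} z c)) (cong proj₂ (FP.remQuot-combine {ℓ} {n} z c)))))

module Design {ℓ n r : ℕ} (core : HadamardCore n r) (m : ℕ) (W : Fin r → Mat ℓ)
  (W-entries : ∀ s x y → Is01M1 (W s x y))
  (W-rows : ∀ s x y → ∑ ℓ (λ z → W s x z * W s y z) ≡ + m * I ℓ x y)
  (W-support : ∑M r (λ s → absM (W s)) ≐ (J ℓ ⊖ I ℓ)) where

  open HadamardCore core
  open BlockGram core m W W-rows public
  open WeighingSupport W W-entries W-support
  open KroneckerIndex ℓ n public

  -- The transposed family also has orthogonal rows; its B is Bᵀ.
  module Transposed = BlockGram core m (λ s x y → W s y x) (λ s → orthogonal-columns ℓ (W s) (+ m) (W-rows s))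

  B-transpose : ∀ x a z c → B z c x a ≡ Transposed.B x a z c
  B-transpose x a z c = cong₂ (λ δ σ → (+ 1 - δ) + σ) (I-sym ℓ z x)
                          (∑-cong r (λ s → cong (W s z x *_) (ℤP.*-comm (u s c) (u s a))))

  S-diagonal : ∀ x a c → S x a x c ≡ + 0
  S-diagonal x a c = trans (∑-cong r (λ s → trans (cong (_* (u s a * u s c)) (diagonal-zero s x)) (ℤP.*-zeroˡ (u s a * u s c))))
                           (∑-zero r)

  S-±1 : ∀ {x z} → x ≢ z → ∀ a c → IsPM1 (S x a z c)
  S-±1 {x} {z} x≢z a c with unique-support x≢z
  ... | s₀ , W-±1 , others = subst IsPM1 (sym single-term) (±1-* W-±1 (±1-* (u-±1 s₀ a) (u-±1 s₀ c)))
    where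
    single-term : S x a z c ≡ W s₀ x z * (u s₀ a * u s₀ c)
    single-term = ∑-single r s₀ (λ s s≢s₀ → trans (cong (_* (u s a * u s c)) (others s s≢s₀)) (ℤP.*-zeroˡ (u s a * u s c)))

  -- On diagonal blocks B vanishes; off them it is 1 ± 1.
  B-0or2 : ∀ x a z c → Dec (x ≡ z) → (B x a z c ≡ + 0) ⊎ (B x a z c ≡ + 2)
  B-0or2 x a .x c (yes refl) = inj₁ (cong₂ (λ δ σ → (+ 1 - δ) + σ) (I-diag ℓ x) (S-diagonal x a c))
  B-0or2 x a z c (no x≢z) with S-±1 x≢z a c
  ... | inj₁ S≡1  = inj₂ (cong₂ (λ δ σ → (+ 1 - δ) + σ) (I-off ℓ x≢z) S≡1)
  ... | inj₂ S≡-1 = inj₁ (cong₂ (λ δ σ → (+ 1 - δ) + σ) (I-off ℓ x≢z) S≡-1)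

  A : Mat (ℓ ℕ.* n)
  A i j = half (B (q i) (ρ i) (q j) (ρ j))

  A-01 : ZeroOneMatrix A
  A-01 i j = half-01 _

  twice-A : ∀ i j → + 2 * A i j ≡ B (q i) (ρ i) (q j) (ρ j)
  twice-A i j = twice-half (B-0or2 (q i) (ρ i) (q j) (ρ j) (q i F.≟ q j))

  four-times : ∀ a b → + 4 * (a * b) ≡ (+ 2 * a) * (+ 2 * b)
  four-times = solve-∀

  A-gram : ∀ i j → + 4 * (A · (A ᵀ)) i j ≡ gram-value ℓ n m (q i) (ρ i) (q j) (ρ j)
  A-gram i j = begin
    + 4 * ∑ (ℓ ℕ.* n) (λ k → A i k * A j k)
      ≡⟨ sym (∑-*ˡ (ℓ ℕ.* n) (+ 4) _) ⟩
    ∑ (ℓ ℕ.* n) (λ k → + 4 * (A i k * A j k))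
      ≡⟨ ∑-cong (ℓ ℕ.* n) (λ k → trans (four-times (A i k) (A j k)) (cong₂ _*_ (twice-A i k) (twice-A j k))) ⟩
    ∑ (ℓ ℕ.* n) (λ k → B (q i) (ρ i) (q k) (ρ k) * B (q j) (ρ j) (q k) (ρ k))
      ≡⟨ ∑-pairs (λ z c → B (q i) (ρ i) z c * B (q j) (ρ j) z c) ⟩
    ∑ ℓ (λ z → ∑ n (λ c → B (q i) (ρ i) z c * B (q j) (ρ j) z c))
      ≡⟨ gram (q i) (ρ i) (q j) (ρ j) ⟩
    gram-value ℓ n m (q i) (ρ i) (q j) (ρ j) ∎

  Aᵀ-gram : ∀ i j → + 4 * ((A ᵀ) · A) i j ≡ gram-value ℓ n m (q i) (ρ i) (q j) (ρ j)
  Aᵀ-gram i j = begin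
    + 4 * ∑ (ℓ ℕ.* n) (λ k → A k i * A k j)
      ≡⟨ sym (∑-*ˡ (ℓ ℕ.* n) (+ 4) _) ⟩
    ∑ (ℓ ℕ.* n) (λ k → + 4 * (A k i * A k j))
      ≡⟨ ∑-cong (ℓ ℕ.* n) (λ k → trans (four-times (A k i) (A k j)) (cong₂ _*_ (twice-A k i) (twice-A k j))) ⟩
    ∑ (ℓ ℕ.* n) (λ k → B (q k) (ρ k) (q i) (ρ i) * B (q k) (ρ k) (q j) (ρ j))
      ≡⟨ ∑-pairs (λ z c → B z c (q i) (ρ i) * B z c (q j) (ρ j)) ⟩
    ∑ ℓ (λ z → ∑ n (λ c → B z c (q i) (ρ i) * B z c (q j) (ρ j)))
      ≡⟨ ∑-cong ℓ (λ z → ∑-cong n (λ c → cong₂ _*_ (B-transpose (q i) (ρ i) z c) (B-transpose (q j) (ρ j) z c))) ⟩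
    ∑ ℓ (λ z → ∑ n (λ c → Transposed.B (q i) (ρ i) z c * Transposed.B (q j) (ρ j) z c))
      ≡⟨ Transposed.gram (q i) (ρ i) (q j) (ρ j) ⟩
    gram-value ℓ n m (q i) (ρ i) (q j) (ρ j) ∎

  -- A K and K A: block sums of B.
  A-K : ∀ i j → + 2 * (A · K ℓ n) i j ≡ + n * P (q i) (q j)
  A-K i j = begin
    + 2 * ∑ (ℓ ℕ.* n) (λ k → A i k * K ℓ n k j)
      ≡⟨ sym (∑-*ˡ (ℓ ℕ.* n) (+ 2) _) ⟩
    ∑ (ℓ ℕ.* n) (λ k → + 2 * (A i k * K ℓ n k j))
      ≡⟨ ∑-cong (ℓ ℕ.* n) (λ k → trans (sym (ℤP.*-assoc (+ 2) (A i k) _)) (cong₂ _*_ (twice-A i k) (K-as-δ k j))) ⟩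
    ∑ (ℓ ℕ.* n) (λ k → B (q i) (ρ i) (q k) (ρ k) * I ℓ (q k) (q j))
      ≡⟨ ∑-pairs (λ z c → B (q i) (ρ i) z c * I ℓ z (q j)) ⟩
    ∑ ℓ (λ z → ∑ n (λ c → B (q i) (ρ i) z c * I ℓ z (q j)))
      ≡⟨ ∑-cong ℓ (λ z → trans (∑-*ʳ n _ _) (cong (_* I ℓ z (q j)) (B-row-sum (q i) (ρ i) z))) ⟩
    ∑ ℓ (λ z → (+ n * P (q i) z) * I ℓ z (q j))
      ≡⟨ ∑-δʳ ℓ (λ z → + n * P (q i) z) (q j) ⟩
    + n * P (q i) (q j) ∎

  K-A : ∀ i j → + 2 * (K ℓ n · A) i j ≡ + n * P (q i) (q j)
  K-A i j = begin
    + 2 * ∑ (ℓ ℕ.* n) (λ k → K ℓ n i k * A k j)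
      ≡⟨ sym (∑-*ˡ (ℓ ℕ.* n) (+ 2) _) ⟩
    ∑ (ℓ ℕ.* n) (λ k → + 2 * (K ℓ n i k * A k j))
      ≡⟨ ∑-cong (ℓ ℕ.* n) (λ k → trans (move-2 (K ℓ n i k) (A k j)) (cong₂ _*_ (K-as-δ i k) (twice-A k j))) ⟩
    ∑ (ℓ ℕ.* n) (λ k → I ℓ (q i) (q k) * B (q k) (ρ k) (q j) (ρ j))
      ≡⟨ ∑-pairs (λ z c → I ℓ (q i) z * B z c (q j) (ρ j)) ⟩
    ∑ ℓ (λ z → ∑ n (λ c → I ℓ (q i) z * B z c (q j) (ρ j)))
      ≡⟨ ∑-cong ℓ (λ z → trans (∑-*ˡ n (I ℓ (q i) z) (λ c → B z c (q j) (ρ j))) (cong (I ℓ (q i) z *_) (B-col-sum z (q j) (ρ j)))) ⟩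
    ∑ ℓ (λ z → I ℓ (q i) z * (+ n * P z (q j)))
      ≡⟨ ∑-δˡ ℓ (λ z → + n * P z (q j)) (q i) ⟩
    + n * P (q i) (q j) ∎
    where
    move-2 : ∀ a b → + 2 * (a * b) ≡ a * (+ 2 * b)
    move-2 = solve-∀

-- From integer identities to the rational parameters: equalities of
-- fractions with denominators 1, 2, 4 are checked after clearing them in ℚᵘ.

toℚᵘ-/ : ∀ (a : ℤ) d → toℚᵘ (a ℚ./ suc d) U.≃ mkℚᵘ a d
toℚᵘ-/ a d = ℚP.toℚᵘ-fromℚᵘ (mkℚᵘ a d)

design-equation-ℚ : ∀ (X p q s e₁ e₂ e₃ : ℤ) →
  + 4 * X ≡ (+ 2 * p) * e₁ + q * e₂ + s * e₃ →
  X ℚ./ 1 ≡ (p ℚ./ 2) ℚ.* (e₁ ℚ./ 1) ℚ.+ (q ℚ./ 4) ℚ.* (e₂ ℚ./ 1) ℚ.+ (s ℚ./ 4) ℚ.* (e₃ ℚ./ 1)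
design-equation-ℚ X p q s e₁ e₂ e₃ four-X = ℚP.toℚᵘ-injective
  (UP.≃-trans (toℚᵘ-/ X 0) (UP.≃-trans (*≡* cleared) (UP.≃-sym rhsᵘ)))
  where
  t₁ = (p ℚ./ 2) ℚ.* (e₁ ℚ./ 1)
  t₂ = (q ℚ./ 4) ℚ.* (e₂ ℚ./ 1)
  t₃ = (s ℚ./ 4) ℚ.* (e₃ ℚ./ 1)
  rhsᵘ : toℚᵘ (t₁ ℚ.+ t₂ ℚ.+ t₃) U.≃ mkℚᵘ p 1 U.* mkℚᵘ e₁ 0 U.+ mkℚᵘ q 3 U.* mkℚᵘ e₂ 0 U.+ mkℚᵘ s 3 U.* mkℚᵘ e₃ 0
  rhsᵘ = UP.≃-trans (ℚP.toℚᵘ-homo-+ (t₁ ℚ.+ t₂) t₃)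
    (UP.+-cong (UP.≃-trans (ℚP.toℚᵘ-homo-+ t₁ t₂)
      (UP.+-cong (UP.≃-trans (ℚP.toℚᵘ-homo-* (p ℚ./ 2) (e₁ ℚ./ 1)) (UP.*-cong (toℚᵘ-/ p 1) (toℚᵘ-/ e₁ 0)))
                 (UP.≃-trans (ℚP.toℚᵘ-homo-* (q ℚ./ 4) (e₂ ℚ./ 1)) (UP.*-cong (toℚᵘ-/ q 3) (toℚᵘ-/ e₂ 0)))))
      (UP.≃-trans (ℚP.toℚᵘ-homo-* (s ℚ./ 4) (e₃ ℚ./ 1)) (UP.*-cong (toℚᵘ-/ s 3) (toℚᵘ-/ e₃ 0))))
  scale : ∀ X → X * + 32 ≡ + 8 * (+ 4 * X)
  scale = solve-∀
  distribute : ∀ p e₁ q e₂ s e₃ → + 8 * ((+ 2 * p) * e₁ + q * e₂ + s * e₃)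
                                ≡ (((p * e₁) * + 4 + (q * e₂) * + 2) * + 4 + (s * e₃) * + 8) * + 1
  distribute = solve-∀
  cleared : X * + 32 ≡ (((p * e₁) * + 4 + (q * e₂) * + 2) * + 4 + (s * e₃) * + 8) * + 1
  cleared = trans (scale X) (trans (cong (+ 8 *_) four-X) (distribute p e₁ q e₂ s e₃))

halving-ℚ : ∀ (X p e : ℤ) → + 2 * X ≡ p * e → X ℚ./ 1 ≡ (p ℚ./ 2) ℚ.* (e ℚ./ 1)
halving-ℚ X p e two-X = ℚP.toℚᵘ-injective (UP.≃-trans (toℚᵘ-/ X 0) (UP.≃-trans (*≡* cleared)
  (UP.≃-sym (UP.≃-trans (ℚP.toℚᵘ-homo-* (p ℚ./ 2) (e ℚ./ 1)) (UP.*-cong (toℚᵘ-/ p 1) (toℚᵘ-/ e 0))))))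
  where
  cleared : X * + 2 ≡ (p * e) * + 1
  cleared = trans (ℤP.*-comm X (+ 2)) (trans two-X (sym (ℤP.*-identityʳ _)))

module Construction (r m : ℕ) (H : Mat (suc r)) (H-had : IsHadamard (suc r) H)
  (W : Fin r → Mat (r ℕ.* m ℕ.+ 1))
  (W-weighing : ∀ s → IsWeighing (r ℕ.* m ℕ.+ 1) m (W s))
  (W-support : ∑M r (λ s → absM (W s)) ≐ (J (r ℕ.* m ℕ.+ 1) ⊖ I (r ℕ.* m ℕ.+ 1))) where

  n = suc r
  ℓ = r ℕ.* m ℕ.+ 1
  L = ℓ ℕ.* n

  core : HadamardCore n r
  core = hadamard-core r H H-had

  -W : Fin r → Mat ℓ
  -W s x y = - W s x y

  -W-rows : ∀ s x y → ∑ ℓ (λ z → -W s x z * -W s y z) ≡ + m * I ℓ x y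
  -W-rows s x y = trans (∑-cong ℓ (λ z → neg-square (W s x z) (W s y z))) (proj₂ (W-weighing s) x y)
    where
    neg-square : ∀ a b → (- a) * (- b) ≡ a * b
    neg-square = solve-∀

  -W-support : ∑M r (λ s → absM (-W s)) ≐ (J ℓ ⊖ I ℓ)
  -W-support x y = trans (∑-cong r (λ s → cong +_ (ℤP.∣-i∣≡∣i∣ (W s x y)))) (W-support x y)

  open HadamardCore core using (u)

  module D⁺ = Design core m W (λ s → proj₁ (W-weighing s)) (λ s → proj₂ (W-weighing s)) W-support
  module D⁻ = Design core m -W (λ s x y → 0±1-neg (proj₁ (W-weighing s) x y)) -W-rows -W-support
  open KroneckerIndex ℓ n

  -- Integer numerators of k = p/2, λ₁ = k₁/4, λ₂ = q₁/4.
  p k₁ q₁ : ℤ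
  p = + (n ℕ.* r ℕ.* m)
  k₁ = (+ n) * ((+ n) - (+ 2)) * (+ m)
  q₁ = (+ n) * ((+ (r ℕ.* m)) - (+ 1))

  -- The Gram value, rewritten in the basis I, K - I, J - K of the group
  -- divisible association scheme.
  gram-value-in-scheme : ∀ i j → gram-value ℓ n m (q i) (ρ i) (q j) (ρ j)
    ≡ (+ 2 * p) * I L i j + k₁ * (K ℓ n i j - I L i j) + q₁ * (+ 1 - K ℓ n i j)
  gram-value-in-scheme i j = begin
    + n * (+ ℓ - + 2 + δq) + + n * ((+ m * δq) * (+ n * δρ - + 1))
      ≡⟨ cong (λ l → + n * (l - + 2 + δq) + + n * ((+ m * δq) * (+ n * δρ - + 1))) ℓ-in-ℤ ⟩
    + n * ((+ r * + m + + 1) - + 2 + δq) + + n * ((+ m * δq) * (+ n * δρ - + 1))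
      ≡⟨ regroup (+ r) (+ m) δq δρ ⟩
    (+ 2 * ((+ n * + r) * + m)) * (δq * δρ) + k₁ * (δq - δq * δρ) + + n * (+ r * + m - + 1) * (+ 1 - δq)
      ≡⟨ cong₂ (λ p′ rm → (+ 2 * p′) * (δq * δρ) + k₁ * (δq - δq * δρ) + + n * (rm - + 1) * (+ 1 - δq))
               (sym p-in-ℤ) (sym (ℤP.pos-* r m)) ⟩
    (+ 2 * p) * (δq * δρ) + k₁ * (δq - δq * δρ) + q₁ * (+ 1 - δq)
      ≡⟨ cong₂ (λ δ κ → (+ 2 * p) * δ + k₁ * (κ - δ) + q₁ * (+ 1 - κ)) (I-kronecker i j) (sym (K-as-δ i j)) ⟩
    (+ 2 * p) * I L i j + k₁ * (K ℓ n i j - I L i j) + q₁ * (+ 1 - K ℓ n i j) ∎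
    where
    δq = I ℓ (q i) (q j)
    δρ = I n (ρ i) (ρ j)
    ℓ-in-ℤ : + ℓ ≡ + r * + m + + 1
    ℓ-in-ℤ = trans (ℤP.pos-+ (r ℕ.* m) 1) (cong (_+ + 1) (ℤP.pos-* r m))
    p-in-ℤ : p ≡ (+ n * + r) * + m
    p-in-ℤ = trans (ℤP.pos-* (n ℕ.* r) m) (cong (_* + m) (ℤP.pos-* n r))
    regroup : ∀ a M δq δρ →
      (+ 1 + a) * ((a * M + + 1) - + 2 + δq) + (+ 1 + a) * ((M * δq) * ((+ 1 + a) * δρ - + 1))
      ≡ (+ 2 * (((+ 1 + a) * a) * M)) * (δq * δρ) + (+ 1 + a) * ((+ 1 + a) - + 2) * M * (δq - δq * δρ)
        + (+ 1 + a) * (a * M - + 1) * (+ 1 - δq)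
    regroup = solve-∀

  design : (A : Mat L) → ZeroOneMatrix A →
    (∀ i j → + 4 * (A · (A ᵀ)) i j ≡ gram-value ℓ n m (q i) (ρ i) (q j) (ρ j)) →
    (∀ i j → + 4 * ((A ᵀ) · A) i j ≡ gram-value ℓ n m (q i) (ρ i) (q j) (ρ j)) →
    IsSGDD (p ℚ./ 2) ℓ n (k₁ ℚ./ 4) (q₁ ℚ./ 4) A
  design A A-01 AAᵀ AᵀA = A-01 , in-ℚ (λ i j → (A · (A ᵀ)) i j) AAᵀ , in-ℚ (λ i j → ((A ᵀ) · A) i j) AᵀA
    where
    in-ℚ : (G : Mat L) → (∀ i j → + 4 * G i j ≡ gram-value ℓ n m (q i) (ρ i) (q j) (ρ j)) →
      ∀ i j → toQ G i j ≡ GDDRHS ℓ n (p ℚ./ 2) (k₁ ℚ./ 4) (q₁ ℚ./ 4) i j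
    in-ℚ G four-G i j = design-equation-ℚ (G i j) p k₁ q₁ (I L i j) (K ℓ n i j - I L i j) (+ 1 - K ℓ n i j)
                          (trans (four-G i j) (gram-value-in-scheme i j))

  -- A⁺ + A⁻ = (J - I) ⊗ J: the weighing parts of B⁺ and B⁻ cancel.
  pair-sum : ∀ i j → D⁺.A i j + D⁻.A i j ≡ + 1 - I ℓ (q i) (q j)
  pair-sum i j = ℤP.*-cancelˡ-≡ (+ 2) _ _ (begin
    + 2 * (D⁺.A i j + D⁻.A i j)         ≡⟨ ℤP.*-distribˡ-+ (+ 2) (D⁺.A i j) (D⁻.A i j) ⟩
    + 2 * D⁺.A i j + + 2 * D⁻.A i j     ≡⟨ cong₂ _+_ (D⁺.twice-A i j) (D⁻.twice-A i j) ⟩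
    (P′ + S⁺) + (P′ + S⁻)               ≡⟨ collect P′ S⁺ S⁻ ⟩
    + 2 * P′ + (S⁺ + S⁻)                ≡⟨ cong (_+_ (+ 2 * P′)) cancel ⟩
    + 2 * P′ + + 0                      ≡⟨ ℤP.+-identityʳ _ ⟩
    + 2 * P′                            ∎)
    where
    P′ = + 1 - I ℓ (q i) (q j)
    S⁺ = D⁺.S (q i) (ρ i) (q j) (ρ j)
    S⁻ = D⁻.S (q i) (ρ i) (q j) (ρ j)
    collect : ∀ P a b → (P + a) + (P + b) ≡ + 2 * P + (a + b)
    collect = solve-∀
    opposite : ∀ w v → w * v + (- w) * v ≡ + 0
    opposite = solve-∀
    cancel : S⁺ + S⁻ ≡ + 0
    cancel = trans (sym (∑-+ r _ _))
               (trans (∑-cong r (λ s → opposite (W s (q i) (q j)) (u s (ρ i) * u s (ρ j)))) (∑-zero r))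

  twin : ZeroOneMatrix (D⁺.A ⊕ D⁻.A)
  twin i j = subst Is01 (sym (pair-sum i j)) (by-cases (q i F.≟ q j))
    where
    by-cases : Dec (q i ≡ q j) → Is01 (+ 1 - I ℓ (q i) (q j))
    by-cases (yes qi≡qj) = inj₁ (cong (λ δ → + 1 - δ) (trans (cong (λ x → I ℓ x (q j)) qi≡qj) (I-diag ℓ (q j))))
    by-cases (no  qi≢qj) = inj₂ (cong (λ δ → + 1 - δ) (I-off ℓ qi≢qj))

  complement : ((D⁺.A ⊕ D⁻.A) ⊕ K ℓ n) ≐ J L
  complement i j = trans (cong₂ _+_ (pair-sum i j) (K-as-δ i j)) (add-back (I ℓ (q i) (q j)))
    where
    add-back : ∀ δ → (+ 1 - δ) + δ ≡ + 1
    add-back = solve-∀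

  block-average : (X : Mat L) → (∀ i j → + 2 * X i j ≡ + n * (+ 1 - I ℓ (q i) (q j))) →
    ∀ i j → toQ X i j ≡ ((+ n) ℚ./ 2) ℚ.* toQ (J L ⊖ K ℓ n) i j
  block-average X two-X i j =
    halving-ℚ (X i j) (+ n) (+ 1 - K ℓ n i j) (trans (two-X i j) (cong (λ δ → + n * (+ 1 - δ)) (sym (K-as-δ i j))))

proposition6p4 : (n m : ℕ) → 1 ≤ n → 1 ≤ m →
    (H : Mat n) → IsHadamard n H →
    (W : Fin (n ∸ 1) → Mat ((n ∸ 1) ℕ.* m ℕ.+ 1)) →
    (∀ s → IsWeighing ((n ∸ 1) ℕ.* m ℕ.+ 1) m (W s)) →
    (∑M (n ∸ 1) (λ s → absM (W s)) ≐ (J ((n ∸ 1) ℕ.* m ℕ.+ 1) ⊖ I ((n ∸ 1) ℕ.* m ℕ.+ 1))) →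
    let ℓ = (n ∸ 1) ℕ.* m ℕ.+ 1
        k = (+ (n ℕ.* (n ∸ 1) ℕ.* m)) ℚ./ 2
        λ₁ = ((+ n) ℤ.* ((+ n) ℤ.- (+ 2)) ℤ.* (+ m)) ℚ./ 4
        λ₂ = ((+ n) ℤ.* ((+ ((n ∸ 1) ℕ.* m)) ℤ.- (+ 1))) ℚ./ 4
        half-n = (+ n) ℚ./ 2
        JK = toQ (J (ℓ ℕ.* n) ⊖ K ℓ n)
    in Σ[ A⁺ ∈ Mat (ℓ ℕ.* n) ] Σ[ A⁻ ∈ Mat (ℓ ℕ.* n) ]
         IsSGDD k ℓ n λ₁ λ₂ A⁺
       × IsSGDD k ℓ n λ₁ λ₂ A⁻
       × ZeroOneMatrix (A⁺ ⊕ A⁻)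
       × (((A⁺ ⊕ A⁻) ⊕ K ℓ n) ≐ J (ℓ ℕ.* n))
       × (∀ i j → toQ (A⁺ · K ℓ n) i j ≡ half-n ℚ.* JK i j)
       × (∀ i j → toQ (K ℓ n · A⁺) i j ≡ half-n ℚ.* JK i j)
       × (∀ i j → toQ (A⁻ · K ℓ n) i j ≡ half-n ℚ.* JK i j)
       × (∀ i j → toQ (K ℓ n · A⁻) i j ≡ half-n ℚ.* JK i j)
proposition6p4 (suc r) m (s≤s z≤n) _ H H-had W W-weighing W-support =
    D⁺.A , D⁻.A
  , design D⁺.A D⁺.A-01 D⁺.A-gram D⁺.Aᵀ-gram
  , design D⁻.A D⁻.A-01 D⁻.A-gram D⁻.Aᵀ-gram
  , twin , complement
  , block-average _ D⁺.A-K , block-average _ D⁺.K-A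
  , block-average _ D⁻.A-K , block-average _ D⁻.K-A
  where open Construction r m H H-had W W-weighing W-support
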